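{- Let $m,n,r,\theta$ be positive integers with $m\ge 2$ and $\big\lfloor\frac{n}{\theta+1}\big\rfloor<\big\lceil\frac{n}{\theta+r}\big\rceil$. Then $K_{m(n)}$ is not $r$-equitably $\big(m\big\lceil\frac{n}{\theta+r}\big\rceil-i\big)$-colorable for every integer $i$ with $1\le i<m$.
   Context: All graphs are finite, simple, undirected. For a positive integer $k$, a (proper) $k$-coloring of a graph $G$ is a map $f:V(G)\to\{1,\dots,k\}$ with $f(x)\ne f(y)$ whenever $xy\in E(G)$; its color classes are the sets $f^{ -1}(i)$, $i=1,\dots,k$. For a positive integer $r$, an $r$-equitable $k$-coloring is a $k$-coloring in which any two color classes differ in size by at most $r$; $G$ is $r$-equitably $k$-colorable if it has one. $K_{m(n)}$ denotes the complete $m$-partite graph with $n$ vertices in each part. -}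

module Defs where

import Data.Nat
open import Data.Nat using (ℕ; _+_; _*_; _∸_; _≤_; _/_)
open import Data.Fin using (Fin; quotient)
open import Data.Fin.Properties using (_≟_)
open import Data.List using (length; filter; allFin)
open import Relation.Binary.PropositionalEquality using (_≡_)
open import Relation.Nullary using (¬_)
open import Level using (Level; suc; _⊔_)

record Graph : Set₁ where
  field
    N     : ℕ
    Adj   : Fin N → Fin N → Set
    irrefl : ∀ x → ¬ Adj x x
    sym   : ∀ {x y} → Adj x y → Adj y x
open Graph public

-- K_{m(n)}: vertices Fin (m * n); vertex v lies in part (quotient n v) ∈ Fin m;
-- two vertices are adjacent iff they lie in different parts.
K : (m n : ℕ) → Graph
K m n = record
  { N = m * n
  ; Adj = λ x y → ¬ (quotient {m} n x ≡ quotient {m} n y)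
  ; irrefl = λ x h → h Relation.Binary.PropositionalEquality.refl
  ; sym = λ h e → h (Relation.Binary.PropositionalEquality.sym e)
  }
  where import Relation.Binary.PropositionalEquality

IsColoring : (G : Graph) (k : ℕ) → (Fin (N G) → Fin k) → Set
IsColoring G k f = ∀ x y → Adj G x y → ¬ (f x ≡ f y)

classSize : (G : Graph) {k : ℕ} → (Fin (N G) → Fin k) → Fin k → ℕ
classSize G f c = length (filter (λ v → f v ≟ c) (allFin (N G)))

IsREquitable : (G : Graph) (r k : ℕ) → (Fin (N G) → Fin k) → Set
IsREquitable G r k f = IsColoring G k f ×' (∀ c d → classSize G f c ≤ classSize G f d + r)
  where open import Data.Product using () renaming (_×_ to _×'_)

REquitablyColorable : (G : Graph) (r k : ℕ) → Set
REquitablyColorable G r k = Σ' (Fin (N G) → Fin k) (IsREquitable G r k)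
  where open import Data.Product using () renaming (Σ to Σ')

-- floor and ceiling division ⌊a/b⌋, ⌈a/b⌉, intended for b ≥ 1
-- (divisor written suc (b ∸ 1), which equals b whenever b ≥ 1).
⌊_/_⌋ : ℕ → ℕ → ℕ
⌊ a / b ⌋ = a / Data.Nat.suc (b ∸ 1)

⌈_/_⌉ : ℕ → ℕ → ℕ
⌈ a / b ⌉ = (a + b ∸ 1) / Data.Nat.suc (b ∸ 1)

-- A colour class of K_{m(n)} is independent, hence lies inside a single part.
-- So if s_j is the number of colours used on part j, then Σ_j s_j ≤ k, with
-- equality when no class is empty. Put C = ⌈n/(θ+r)⌉ and k = mC − i.
-- If every class has at least θ+1 vertices, then (θ+1) s_j ≤ n < (θ+1) C, so
-- s_j ≤ C − 1 and k ≤ m(C − 1) < k. Otherwise some class has at most θ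
-- vertices, r-equitability bounds every class by θ+r, and then
-- (θ+r) s_j ≥ n > (θ+r)(C − 1) gives s_j ≥ C, so mC ≤ k < mC.

module Submission where

open import Defs
open import Data.Nat using (ℕ; _+_; _*_; _∸_; _≤_; _<_)
open import Relation.Nullary using (¬_)

open import Data.Nat using (zero; suc; z≤n; s≤s; _/_; _%_; _≤?_)
open import Data.Nat.Properties hiding (_≟_)
open import Data.Nat.DivMod using (m≡m%n+[m/n]*n; m%n<n; m/n*n≤m)
open import Data.Fin using (Fin; zero; suc; quotient; combine; _↑ˡ_; _↑ʳ_)
open import Data.Fin.Properties using (_≟_; remQuot-combine; all?; ¬∀⟶∃¬)
import Data.Fin.Properties as Finₚ
open import Data.List using (length; filter; tabulate)
open import Data.Product using (∃; _,_; proj₁)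
open import Function using (_∘_)
open import Data.Empty using (⊥-elim)
open import Relation.Nullary using (Dec; yes; no)
open import Relation.Unary using (Pred; Decidable)
open import Relation.Binary.PropositionalEquality
  using (_≡_; _≢_; refl; cong; trans; subst; module ≡-Reasoning)
  renaming (sym to ≡-sym)
open import Algebra.Properties.Semiring.Sum +-*-semiring
  using (sum; sum-syntax; sum-cong-≗; ∑-comm; ∑-distrib-+; *-distribˡ-sum)

∑-const : ∀ n c → ∑[ i < n ] c ≡ n * c
∑-const zero    c = refl
∑-const (suc n) c = cong (c +_) (∑-const n c)

∑-mono-≤ : ∀ {n} {f g : Fin n → ℕ} → (∀ i → f i ≤ g i) → sum f ≤ sum g
∑-mono-≤ {zero}  _   = z≤n
∑-mono-≤ {suc n} f≤g = +-mono-≤ (f≤g zero) (∑-mono-≤ (f≤g ∘ suc))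

term≤∑ : ∀ {n} (f : Fin n → ℕ) i → f i ≤ sum f
term≤∑ f zero    = m≤m+n (f zero) _
term≤∑ f (suc i) = ≤-trans (term≤∑ (f ∘ suc) i) (m≤n+m _ (f zero))

∑-pos⇒∃-pos : ∀ {n} (f : Fin n → ℕ) → 0 < sum f → ∃ λ i → 0 < f i
∑-pos⇒∃-pos {suc n} f ∑f>0 with f zero in eq
... | suc _ = zero , subst (0 <_) (≡-sym eq) 0<1+n
... | zero  with ∑-pos⇒∃-pos (f ∘ suc) ∑f>0
...   | i , fi>0 = suc i , fi>0

∑-single : ∀ {n} (f : Fin n → ℕ) j → (∀ i → i ≢ j → f i ≡ 0) → sum f ≡ f j
∑-single {suc n} f zero    vanish = begin
  f zero + ∑[ i < n ] f (suc i) ≡⟨ cong (f zero +_) (sum-cong-≗ (λ i → vanish (suc i) λ ())) ⟩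
  f zero + ∑[ i < n ] 0         ≡⟨ cong (f zero +_) (∑-const n 0) ⟩
  f zero + n * 0                ≡⟨ cong (f zero +_) (*-zeroʳ n) ⟩
  f zero + 0                    ≡⟨ +-identityʳ (f zero) ⟩
  f zero                        ∎
  where open ≡-Reasoning
∑-single {suc n} f (suc j) vanish rewrite vanish zero (λ ()) =
  ∑-single (f ∘ suc) j (λ i i≢j → vanish (suc i) (i≢j ∘ Finₚ.suc-injective))

∑-↑ : ∀ a b (f : Fin (a + b) → ℕ) →
  sum f ≡ ∑[ i < a ] f (i ↑ˡ b) + ∑[ i < b ] f (a ↑ʳ i)
∑-↑ zero    b f = refl
∑-↑ (suc a) b f = trans (cong (f zero +_) (∑-↑ a b (f ∘ suc))) (≡-sym (+-assoc (f zero) _ _))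

∑-combine : ∀ m n (f : Fin (m * n) → ℕ) →
  sum f ≡ ∑[ j < m ] ∑[ t < n ] f (combine j t)
∑-combine zero    n f = refl
∑-combine (suc m) n f =
  trans (∑-↑ n (m * n) f) (cong (∑[ t < n ] f (t ↑ˡ (m * n)) +_) (∑-combine m n (f ∘ (n ↑ʳ_))))

𝟙 : ∀ {p} {P : Set p} → Dec P → ℕ
𝟙 (yes _) = 1
𝟙 (no  _) = 0

𝟙-pos⇒holds : ∀ {p} {P : Set p} (P? : Dec P) → 0 < 𝟙 P? → P
𝟙-pos⇒holds (yes p) _ = p

∑-𝟙-≟ : ∀ {k} (x : Fin k) → ∑[ c < k ] 𝟙 (x ≟ c) ≡ 1
∑-𝟙-≟ x = trans (∑-single (λ c → 𝟙 (x ≟ c)) x 𝟙-off-x) 𝟙-at-x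
  where
  𝟙-off-x : ∀ c → c ≢ x → 𝟙 (x ≟ c) ≡ 0
  𝟙-off-x c c≢x with x ≟ c
  ... | yes x≡c = ⊥-elim (c≢x (≡-sym x≡c))
  ... | no  _   = refl
  𝟙-at-x : 𝟙 (x ≟ x) ≡ 1
  𝟙-at-x with x ≟ x
  ... | yes _   = refl
  ... | no  x≢x = ⊥-elim (x≢x refl)

length-filter-tabulate : ∀ {a p} {A : Set a} {P : Pred A p} (P? : Decidable P) {n} (g : Fin n → A) →
  length (filter P? (tabulate g)) ≡ ∑[ i < n ] 𝟙 (P? (g i))
length-filter-tabulate P? {zero}  g = refl
length-filter-tabulate P? {suc n} g with P? (g zero)
... | yes _ = cong suc (length-filter-tabulate P? (g ∘ suc))
... | no  _ = length-filter-tabulate P? (g ∘ suc)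

AtMostOnePositive : ∀ {n} → (Fin n → ℕ) → Set
AtMostOnePositive f = ∀ i j → 0 < f i → 0 < f j → i ≡ j

module _ {n} {f : Fin n → ℕ} (unique : AtMostOnePositive f) where

  ∑-≡-positive-term : ∀ {i} → 0 < f i → sum f ≡ f i
  ∑-≡-positive-term {i} fi>0 = ∑-single f i vanish
    where
    vanish : ∀ j → j ≢ i → f j ≡ 0
    vanish j j≢i with f j in eq
    ... | zero  = refl
    ... | suc _ = ⊥-elim (j≢i (unique j i (subst (0 <_) (≡-sym eq) 0<1+n) fi>0))

  ∑-≤-bound : ∀ {b} → (∀ i → f i ≤ b) → sum f ≤ b
  ∑-≤-bound {b} f≤b with sum f in eq
  ... | zero  = z≤n
  ... | suc _ with ∑-pos⇒∃-pos f (subst (0 <_) (≡-sym eq) 0<1+n)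
  ...   | i , fi>0 = subst (_≤ b) (trans (≡-sym (∑-≡-positive-term fi>0)) eq) (f≤b i)

signum : ℕ → ℕ
signum zero    = 0
signum (suc _) = 1

signum≤1 : ∀ x → signum x ≤ 1
signum≤1 zero    = z≤n
signum≤1 (suc _) = ≤-refl

signum-pos⇒pos : ∀ {x} → 0 < signum x → 0 < x
signum-pos⇒pos {suc _} _ = 0<1+n

pos⇒signum-pos : ∀ {x} → 0 < x → 0 < signum x
pos⇒signum-pos {suc _} _ = 0<1+n

*-signum≤ : ∀ a x → (0 < x → a ≤ x) → a * signum x ≤ x
*-signum≤ a zero    _   = ≤-reflexive (*-zeroʳ a)
*-signum≤ a (suc x) a≤x = subst (_≤ suc x) (≡-sym (*-identityʳ a)) (a≤x 0<1+n)

≤*-signum : ∀ b x → x ≤ b → x ≤ b * signum x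
≤*-signum b zero    _   = z≤n
≤*-signum b (suc x) x≤b = subst (suc x ≤_) (≡-sym (*-identityʳ b)) x≤b

module Support {m k : ℕ} (M : Fin m → Fin k → ℕ) where

  support : Fin m → ℕ
  support j = ∑[ c < k ] signum (M j c)

  support< : ∀ {a C} j → (∀ c → 0 < M j c → a ≤ M j c) →
             ∑[ c < k ] M j c < a * C → support j < C
  support< {a} {C} j large ∑<a*C = *-cancelˡ-< a (support j) C (≤-<-trans a*support≤∑ ∑<a*C)
    where
    open ≤-Reasoning
    a*support≤∑ : a * support j ≤ ∑[ c < k ] M j c
    a*support≤∑ = begin
      a * support j                     ≡⟨ *-distribˡ-sum a (λ c → signum (M j c)) ⟩
      ∑[ c < k ] (a * signum (M j c))   ≤⟨ ∑-mono-≤ (λ c → *-signum≤ a (M j c) (large c)) ⟩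
      ∑[ c < k ] M j c                  ∎

  ≤support : ∀ {b C} j → (∀ c → M j c ≤ b) →
             b * C < ∑[ c < k ] M j c + b → C ≤ support j
  ≤support {b} {C} j small b*C<∑+b = m<1+n⇒m≤n (*-cancelˡ-< b C (suc (support j)) (begin-strict
      b * C                                <⟨ b*C<∑+b ⟩
      ∑[ c < k ] M j c + b                 ≤⟨ +-monoˡ-≤ b ∑≤b*support ⟩
      b * support j + b                    ≡⟨ +-comm (b * support j) b ⟩
      b + b * support j                    ≡⟨ *-suc b (support j) ⟨
      b * suc (support j)                  ∎))
    where
    open ≤-Reasoning
    ∑≤b*support : ∑[ c < k ] M j c ≤ b * support j
    ∑≤b*support = begin
      ∑[ c < k ] M j c                  ≤⟨ ∑-mono-≤ (λ c → ≤*-signum b (M j c) (small c)) ⟩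
      ∑[ c < k ] (b * signum (M j c))   ≡⟨ *-distribˡ-sum b (λ c → signum (M j c)) ⟨
      b * support j                     ∎

  k≤∑support : (∀ c → 0 < ∑[ j < m ] M j c) → k ≤ ∑[ j < m ] support j
  k≤∑support nonempty = begin
    k                                          ≡⟨ *-identityʳ k ⟨
    k * 1                                      ≡⟨ ∑-const k 1 ⟨
    ∑[ c < k ] 1                               ≤⟨ ∑-mono-≤ column≥1 ⟩
    ∑[ c < k ] ∑[ j < m ] signum (M j c)       ≡⟨ ∑-comm (λ j c → signum (M j c)) ⟨
    ∑[ j < m ] support j                       ∎
    where
    open ≤-Reasoning
    column≥1 : ∀ c → 1 ≤ ∑[ j < m ] signum (M j c)
    column≥1 c with ∑-pos⇒∃-pos (λ j → M j c) (nonempty c)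
    ... | j , Mjc>0 = ≤-trans (pos⇒signum-pos Mjc>0) (term≤∑ (λ j → signum (M j c)) j)

  ∑support≤k : (∀ c → AtMostOnePositive (λ j → M j c)) → ∑[ j < m ] support j ≤ k
  ∑support≤k unique = begin
    ∑[ j < m ] support j                       ≡⟨ ∑-comm (λ j c → signum (M j c)) ⟩
    ∑[ c < k ] ∑[ j < m ] signum (M j c)       ≤⟨ ∑-mono-≤ column≤1 ⟩
    ∑[ c < k ] 1                               ≡⟨ ∑-const k 1 ⟩
    k * 1                                      ≡⟨ *-identityʳ k ⟩
    k                                          ∎
    where
    open ≤-Reasoning
    column≤1 : ∀ c → ∑[ j < m ] signum (M j c) ≤ 1
    column≤1 c = ∑-≤-bound (λ i j p q → unique c i j (signum-pos⇒pos p) (signum-pos⇒pos q))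
                           (λ j → signum≤1 (M j c))

quotient-combine : ∀ {m n} (j : Fin m) (t : Fin n) → quotient {m} n (combine j t) ≡ j
quotient-combine j t = cong proj₁ (remQuot-combine j t)

module ProperColouring {m n k : ℕ} {f : Fin (m * n) → Fin k}
                       (proper : IsColoring (K m n) k f) where

  partCount : Fin m → Fin k → ℕ
  partCount j c = ∑[ t < n ] 𝟙 (f (combine j t) ≟ c)

  open Support partCount

  classSize≡∑partCount : ∀ c → classSize (K m n) f c ≡ ∑[ j < m ] partCount j c
  classSize≡∑partCount c =
    trans (length-filter-tabulate (λ v → f v ≟ c) (λ v → v)) (∑-combine m n (λ v → 𝟙 (f v ≟ c)))

  ∑partCount≡n : ∀ j → ∑[ c < k ] partCount j c ≡ n
  ∑partCount≡n j = begin
    ∑[ c < k ] ∑[ t < n ] 𝟙 (f (combine j t) ≟ c)   ≡⟨ ∑-comm (λ c t → 𝟙 (f (combine j t) ≟ c)) ⟩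
    ∑[ t < n ] ∑[ c < k ] 𝟙 (f (combine j t) ≟ c)   ≡⟨ sum-cong-≗ (λ t → ∑-𝟙-≟ (f (combine j t))) ⟩
    ∑[ t < n ] 1                                    ≡⟨ ∑-const n 1 ⟩
    n * 1                                           ≡⟨ *-identityʳ n ⟩
    n                                               ∎
    where open ≡-Reasoning

  classInOnePart : ∀ c → AtMostOnePositive (λ j → partCount j c)
  classInOnePart c j j' Njc>0 Nj'c>0
    with ∑-pos⇒∃-pos _ Njc>0 | ∑-pos⇒∃-pos _ Nj'c>0 | j ≟ j'
  ... | _ , _ | _ , _ | yes j≡j' = j≡j'
  ... | t , fjt≡c | t' , fj't'≡c | no j≢j' =
    ⊥-elim (proper (combine j t) (combine j' t') differentParts
                   (trans (𝟙-pos⇒holds _ fjt≡c) (≡-sym (𝟙-pos⇒holds _ fj't'≡c))))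
    where
    differentParts : Adj (K m n) (combine j t) (combine j' t')
    differentParts same = j≢j' (trans (≡-sym (quotient-combine j t))
                                      (trans same (quotient-combine j' t')))

  partCount≤classSize : ∀ j c → partCount j c ≤ classSize (K m n) f c
  partCount≤classSize j c =
    subst (partCount j c ≤_) (≡-sym (classSize≡∑partCount c)) (term≤∑ (λ j → partCount j c) j)

  partCount-pos⇒≡classSize : ∀ {j c} → 0 < partCount j c → partCount j c ≡ classSize (K m n) f c
  partCount-pos⇒≡classSize {j} {c} Njc>0 =
    ≡-sym (trans (classSize≡∑partCount c) (∑-≡-positive-term (classInOnePart c) Njc>0))

  largeClasses⇒k+m≤m*C : ∀ {a C} → 0 < a → (∀ c → a ≤ classSize (K m n) f c) → n < a * C → k + m ≤ m * C
  largeClasses⇒k+m≤m*C {a} {C} a>0 large n<a*C = begin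
    k + m                                       ≡⟨ +-comm k m ⟩
    m + k                                       ≤⟨ +-monoʳ-≤ m (k≤∑support nonempty) ⟩
    m + ∑[ j < m ] support j                    ≡⟨ cong (_+ ∑[ j < m ] support j) (trans (∑-const m 1) (*-identityʳ m)) ⟨
    ∑[ j < m ] 1 + ∑[ j < m ] support j         ≡⟨ ∑-distrib-+ (λ _ → 1) support ⟨
    ∑[ j < m ] suc (support j)                  ≤⟨ ∑-mono-≤ fewColours ⟩
    ∑[ j < m ] C                                ≡⟨ ∑-const m C ⟩
    m * C                                       ∎
    where
    open ≤-Reasoning
    nonempty : ∀ c → 0 < ∑[ j < m ] partCount j c
    nonempty c = subst (0 <_) (classSize≡∑partCount c) (≤-trans a>0 (large c))
    fewColours : ∀ j → support j < C
    fewColours j = support< j (λ c Njc>0 → subst (a ≤_) (≡-sym (partCount-pos⇒≡classSize Njc>0)) (large c))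
                              (subst (_< a * C) (≡-sym (∑partCount≡n j)) n<a*C)

  smallClasses⇒m*C≤k : ∀ {b C} → (∀ c → classSize (K m n) f c ≤ b) → b * C < n + b → m * C ≤ k
  smallClasses⇒m*C≤k {b} {C} small b*C<n+b = begin
    m * C                    ≡⟨ ∑-const m C ⟨
    ∑[ j < m ] C             ≤⟨ ∑-mono-≤ manyColours ⟩
    ∑[ j < m ] support j     ≤⟨ ∑support≤k classInOnePart ⟩
    k                        ∎
    where
    open ≤-Reasoning
    manyColours : ∀ j → C ≤ support j
    manyColours j = ≤support j (λ c → ≤-trans (partCount≤classSize j c) (small c))
                               (subst (λ x → b * C < x + b) (≡-sym (∑partCount≡n j)) b*C<n+b)

⌊x/d⌋<C⇒x<d*C : ∀ x d C → ⌊ x / suc d ⌋ < C → x < suc d * C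
⌊x/d⌋<C⇒x<d*C x d C ⌊x/d⌋<C = begin-strict
  x                                ≡⟨ m≡m%n+[m/n]*n x (suc d) ⟩
  x % suc d + x / suc d * suc d    <⟨ +-monoˡ-< _ (m%n<n x (suc d)) ⟩
  suc (x / suc d) * suc d          ≤⟨ *-monoˡ-≤ (suc d) ⌊x/d⌋<C ⟩
  C * suc d                        ≡⟨ *-comm C (suc d) ⟩
  suc d * C                        ∎
  where open ≤-Reasoning

d*⌈x/d⌉<x+d : ∀ x d → suc d * ⌈ x / suc d ⌉ < x + suc d
d*⌈x/d⌉<x+d x d = begin-strict
  suc d * ⌈ x / suc d ⌉            ≡⟨ *-comm (suc d) _ ⟩
  ⌈ x / suc d ⌉ * suc d            ≤⟨ m/n*n≤m (x + suc d ∸ 1) (suc d) ⟩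
  x + suc d ∸ 1                    ≡⟨ cong (_∸ 1) (+-suc x d) ⟩
  x + d                            <⟨ +-monoʳ-< x ≤-refl ⟩
  x + suc d                        ∎
  where open ≤-Reasoning

m<m∸n+o : ∀ m {n o} → n < o → m < m ∸ n + o
m<m∸n+o m {n} {o} n<o = begin-strict
  m             ≤⟨ m≤n+m∸n m n ⟩
  n + (m ∸ n)   <⟨ +-monoˡ-< (m ∸ n) n<o ⟩
  o + (m ∸ n)   ≡⟨ +-comm o (m ∸ n) ⟩
  m ∸ n + o     ∎
  where open ≤-Reasoning

m∸n<m : ∀ {m n} → 0 < m → 0 < n → m ∸ n < m
m∸n<m {suc m} {suc n} _ _ = s≤s (m∸n≤m m n)

lemma12 : (m n r θ : ℕ) → 2 ≤ m → 1 ≤ n → 1 ≤ r → 1 ≤ θ →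
    ⌊ n / (θ + 1) ⌋ < ⌈ n / (θ + r) ⌉ →
    (i : ℕ) → 1 ≤ i → i < m →
    ¬ REquitablyColorable (K m n) r (m * ⌈ n / (θ + r) ⌉ ∸ i)
-- The bound variable θ is the paper's θ − 1, so that the divisors suc (b ∸ 1) of
-- ⌊_/_⌋ and ⌈_/_⌉ reduce to suc (θ + 1) and suc (θ + r).
lemma12 m n r (suc θ) 2≤m _ _ _ ⌊n/θ+1⌋<C i 1≤i i<m (f , proper , equitable)
  with all? (λ c → suc θ + 1 ≤? classSize (K m n) f c)
... | yes large =
  <⇒≱ (m<m∸n+o (m * ⌈ n / (suc θ + r) ⌉) i<m)
      (largeClasses⇒k+m≤m*C 0<1+n large (⌊x/d⌋<C⇒x<d*C n (θ + 1) _ ⌊n/θ+1⌋<C))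
  where open ProperColouring proper
... | no notLarge with ¬∀⟶∃¬ _ _ (λ c → suc θ + 1 ≤? classSize (K m n) f c) notLarge
...   | c₀ , c₀-notLarge =
  <⇒≱ (m∸n<m (*-mono-≤ (m<n⇒0<n 2≤m) (m<n⇒0<n ⌊n/θ+1⌋<C)) 1≤i)
      (smallClasses⇒m*C≤k small (d*⌈x/d⌉<x+d n (θ + r)))
  where
  open ProperColouring proper
  c₀-small : classSize (K m n) f c₀ ≤ suc θ
  c₀-small = subst (classSize (K m n) f c₀ ≤_) (+-comm θ 1) (m<1+n⇒m≤n (≰⇒> c₀-notLarge))
  small : ∀ c → classSize (K m n) f c ≤ suc θ + r
  small c = ≤-trans (equitable c c₀) (+-monoˡ-≤ r c₀-small)
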